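{- Let $\mathbf L=(L,\vee,\wedge,0,1)$ be a complemented modular lattice. Then the following are equivalent: (i) $\mathbf L$ satisfies the identity $x^{++}\approx x$, i.e. $x^{++}=\{x\}$ for all $x\in L$; (ii) for every $x\in L$ and each $y\in x^{++}$ there exists some $z\in y^+$ such that $(x\vee y)\wedge z=0$ or $(x\wedge y)\vee z=1$.
   Context: A bounded lattice is complemented if every element $a$ has some $b$ with $a\vee b=1$, $a\wedge b=0$ (complements need not be unique); lattices are non-trivial. For $A\subseteq L$, $A^+:=\{x\in L\mid a\vee x=1\text{ and }a\wedge x=0\text{ for all }a\in A\}$; $a^+:=\{a\}^+$ and $a^{++}:=(a^+)^+$. -}

module Defs where

open import Level using (Level; _⊔_; suc)
open import Data.Product using (Σ; _×_; _,_)
open import Data.Sum using (_⊎_)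
open import Relation.Nullary using (¬_)
open import Algebra.Lattice.Bundles using (Lattice)

record ComplementedModularLattice c ℓ : Set (suc (c ⊔ ℓ)) where
  field
    lattice : Lattice c ℓ
  open Lattice lattice public
  field
    𝟘 𝟙         : Carrier
    ∨-identityʳ : ∀ x → (x ∨ 𝟘) ≈ x
    ∧-identityʳ : ∀ x → (x ∧ 𝟙) ≈ x
    nontrivial  : ¬ (𝟘 ≈ 𝟙)
    -- modular law: x ≤ z implies x ∨ (y ∧ z) = (x ∨ y) ∧ z, with x ≤ z meaning x ∧ z ≈ x
    modular     : ∀ x y z → (x ∧ z) ≈ x → (x ∨ (y ∧ z)) ≈ ((x ∨ y) ∧ z)
    complemented : ∀ a → Σ Carrier (λ b → ((a ∨ b) ≈ 𝟙) × ((a ∧ b) ≈ 𝟘))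

module _ {c ℓ} (L : ComplementedModularLattice c ℓ) where
  open ComplementedModularLattice L

  _⁺ : ∀ {p} → (Carrier → Set p) → (Carrier → Set (c ⊔ p ⊔ ℓ))
  (A ⁺) x = ∀ a → A a → ((a ∨ x) ≈ 𝟙) × ((a ∧ x) ≈ 𝟘)

  ⟦_⟧ : Carrier → (Carrier → Set ℓ)
  ⟦ a ⟧ y = y ≈ a

  _⁺¹ : Carrier → (Carrier → Set (c ⊔ ℓ))
  a ⁺¹ = ⟦ a ⟧ ⁺

  _⁺⁺ : Carrier → (Carrier → Set (c ⊔ ℓ))
  a ⁺⁺ = (a ⁺¹) ⁺

  ConditionI : Set (c ⊔ ℓ)
  ConditionI = ∀ x y → ((x ⁺⁺) y → y ≈ x) × (y ≈ x → (x ⁺⁺) y)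

  ConditionII : Set (c ⊔ ℓ)
  ConditionII = ∀ x y → (x ⁺⁺) y →
    Σ Carrier (λ z → (y ⁺¹) z ×
      ((((x ∨ y) ∧ z) ≈ 𝟘) ⊎ (((x ∧ y) ∨ z) ≈ 𝟙)))

-- Every y ∈ x⁺⁺ is a complement of every complement of x.  In a modular
-- lattice two comparable elements with a common complement coincide, so
-- y ≈ x as soon as y and x are comparable.  Condition (ii) supplies a
-- complement z of y making x ∨ y (resp. x ∧ y) a second complement of z;
-- as y ≤ x ∨ y (resp. x ∧ y ≤ y) this forces x ≤ y (resp. y ≤ x).
-- Conversely, under (i) any complement z of y = x satisfies (x ∧ y) ∨ z ≈ 1.
module Submission where

open import Defs
open import Data.Product using (_×_; _,_; proj₁; proj₂)
open import Data.Sum using (inj₁; inj₂)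
import Algebra.Lattice.Properties.Lattice as LatticeProperties
import Relation.Binary.Reasoning.Setoid as SetoidReasoning

module ComplementedModular {c ℓ} (L : ComplementedModularLattice c ℓ) where
  open ComplementedModularLattice L
  open LatticeProperties lattice using (∧-idem)
  open SetoidReasoning setoid

  infix 4 _≤_ _IsComplementOf_

  _≤_ : Carrier → Carrier → Set ℓ
  x ≤ y = (x ∧ y) ≈ x

  _IsComplementOf_ : Carrier → Carrier → Set ℓ
  z IsComplementOf y = ((y ∨ z) ≈ 𝟙) × ((y ∧ z) ≈ 𝟘)

  IsComplementOf-sym : ∀ {y z} → z IsComplementOf y → y IsComplementOf z
  IsComplementOf-sym (y∨z , y∧z) = trans (∨-comm _ _) y∨z , trans (∧-comm _ _) y∧z

  IsComplementOf-resp-≈ : ∀ {x y z} → y ≈ x → z IsComplementOf x → z IsComplementOf y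
  IsComplementOf-resp-≈ y≈x (x∨z , x∧z) = trans (∨-congʳ y≈x) x∨z , trans (∧-congʳ y≈x) x∧z

  y≤x∨y : ∀ x y → y ≤ x ∨ y
  y≤x∨y x y = trans (∧-congˡ (∨-comm x y)) (∧-absorbs-∨ y x)

  x∧y≤y : ∀ x y → x ∧ y ≤ y
  x∧y≤y x y = trans (∧-assoc x y y) (∧-congˡ (∧-idem y))

  ∨-zeroʳ : ∀ x → (x ∨ 𝟙) ≈ 𝟙
  ∨-zeroʳ x = begin
    x ∨ 𝟙        ≈⟨ ∨-congʳ (∧-identityʳ x) ⟨
    (x ∧ 𝟙) ∨ 𝟙  ≈⟨ ∨-comm _ _ ⟩
    𝟙 ∨ (x ∧ 𝟙)  ≈⟨ ∨-congˡ (∧-comm _ _) ⟩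
    𝟙 ∨ (𝟙 ∧ x)  ≈⟨ ∨-absorbs-∧ 𝟙 x ⟩
    𝟙            ∎

  ∧-zeroʳ : ∀ x → (x ∧ 𝟘) ≈ 𝟘
  ∧-zeroʳ x = begin
    x ∧ 𝟘        ≈⟨ ∧-congʳ (∨-identityʳ x) ⟨
    (x ∨ 𝟘) ∧ 𝟘  ≈⟨ ∧-comm _ _ ⟩
    𝟘 ∧ (x ∨ 𝟘)  ≈⟨ ∧-congˡ (∨-comm _ _) ⟩
    𝟘 ∧ (𝟘 ∨ x)  ≈⟨ ∧-absorbs-∨ 𝟘 x ⟩
    𝟘            ∎

  ≤-commonComplement⇒≈ : ∀ {a w z} → a ≤ w →
    z IsComplementOf a → z IsComplementOf w → w ≈ a
  ≤-commonComplement⇒≈ {a} {w} {z} a≤w (a∨z , _) (_ , w∧z) = begin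
    w            ≈⟨ ∧-identityʳ w ⟨
    w ∧ 𝟙        ≈⟨ ∧-congˡ a∨z ⟨
    w ∧ (a ∨ z)  ≈⟨ ∧-comm _ _ ⟩
    (a ∨ z) ∧ w  ≈⟨ modular a z w a≤w ⟨
    a ∨ (z ∧ w)  ≈⟨ ∨-congˡ (trans (∧-comm _ _) w∧z) ⟩
    a ∨ 𝟘        ≈⟨ ∨-identityʳ a ⟩
    a            ∎

  ∈⁺¹⇒IsComplementOf : ∀ {y z} → (L ⁺¹) y z → z IsComplementOf y
  ∈⁺¹⇒IsComplementOf z∈y⁺ = z∈y⁺ _ refl

  IsComplementOf⇒∈⁺¹ : ∀ {y z} → z IsComplementOf y → (L ⁺¹) y z
  IsComplementOf⇒∈⁺¹ z-compl a a≈y = IsComplementOf-resp-≈ a≈y z-compl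

  ≈⇒∈⁺⁺ : ∀ {x y} → y ≈ x → (L ⁺⁺) x y
  ≈⇒∈⁺⁺ y≈x z z∈x⁺ =
    IsComplementOf-sym (IsComplementOf-resp-≈ y≈x (∈⁺¹⇒IsComplementOf z∈x⁺))

  ∈⁺⁺⇒IsComplementOf : ∀ {x y k} → (L ⁺⁺) x y → k IsComplementOf x → y IsComplementOf k
  ∈⁺⁺⇒IsComplementOf y∈x⁺⁺ k-compl = y∈x⁺⁺ _ (IsComplementOf⇒∈⁺¹ k-compl)

  module _ {x y} (y∈x⁺⁺ : (L ⁺⁺) x y) where

    private
      k : Carrier
      k = proj₁ (complemented x)

      k-compl : k IsComplementOf x
      k-compl = proj₂ (complemented x)

      k-compl′ : k IsComplementOf y
      k-compl′ = IsComplementOf-sym (∈⁺⁺⇒IsComplementOf y∈x⁺⁺ k-compl)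

    ∈⁺⁺∧≥⇒≈ : x ≤ y → y ≈ x
    ∈⁺⁺∧≥⇒≈ x≤y = ≤-commonComplement⇒≈ x≤y k-compl k-compl′

    ∈⁺⁺∧≤⇒≈ : y ≤ x → y ≈ x
    ∈⁺⁺∧≤⇒≈ y≤x = sym (≤-commonComplement⇒≈ y≤x k-compl′ k-compl)

  ∨-disjoint⇒≤ : ∀ {x y z} → z IsComplementOf y → ((x ∨ y) ∧ z) ≈ 𝟘 → x ≤ y
  ∨-disjoint⇒≤ {x} {y} {z} z-compl@(y∨z , _) x∨y∧z = begin
    x ∧ y        ≈⟨ ∧-congˡ x∨y≈y ⟨
    x ∧ (x ∨ y)  ≈⟨ ∧-absorbs-∨ x y ⟩
    x            ∎
    where
    x∨y∨z : ((x ∨ y) ∨ z) ≈ 𝟙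
    x∨y∨z = trans (∨-assoc x y z) (trans (∨-congˡ y∨z) (∨-zeroʳ x))

    x∨y≈y : (x ∨ y) ≈ y
    x∨y≈y = ≤-commonComplement⇒≈ (y≤x∨y x y) z-compl (x∨y∨z , x∨y∧z)

  ∧-codisjoint⇒≤ : ∀ {x y z} → z IsComplementOf y → ((x ∧ y) ∨ z) ≈ 𝟙 → y ≤ x
  ∧-codisjoint⇒≤ {x} {y} {z} z-compl@(_ , y∧z) x∧y∨z = begin
    y ∧ x  ≈⟨ ∧-comm y x ⟩
    x ∧ y  ≈⟨ y≈x∧y ⟨
    y      ∎
    where
    x∧y∧z : ((x ∧ y) ∧ z) ≈ 𝟘
    x∧y∧z = trans (∧-assoc x y z) (trans (∧-congˡ y∧z) (∧-zeroʳ x))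

    y≈x∧y : y ≈ (x ∧ y)
    y≈x∧y = ≤-commonComplement⇒≈ (x∧y≤y x y) (x∧y∨z , x∧y∧z) z-compl

  i⇒ii : ConditionI L → ConditionII L
  i⇒ii i x y y∈x⁺⁺ = z , IsComplementOf⇒∈⁺¹ z-compl , inj₂ x∧y∨z
    where
    z : Carrier
    z = proj₁ (complemented y)

    z-compl : z IsComplementOf y
    z-compl = proj₂ (complemented y)

    x∧y≈y : (x ∧ y) ≈ y
    x∧y≈y = trans (∧-congʳ (sym (proj₁ (i x y) y∈x⁺⁺))) (∧-idem y)

    x∧y∨z : ((x ∧ y) ∨ z) ≈ 𝟙
    x∧y∨z = trans (∨-congʳ x∧y≈y) (proj₁ z-compl)

  ii⇒i : ConditionII L → ConditionI L
  ii⇒i ii x y = ∈⁺⁺⇒≈ , ≈⇒∈⁺⁺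
    where
    ∈⁺⁺⇒≈ : (L ⁺⁺) x y → y ≈ x
    ∈⁺⁺⇒≈ y∈x⁺⁺ with ii x y y∈x⁺⁺
    ... | z , z∈y⁺ , inj₁ x∨y∧z =
      ∈⁺⁺∧≥⇒≈ y∈x⁺⁺ (∨-disjoint⇒≤ (∈⁺¹⇒IsComplementOf z∈y⁺) x∨y∧z)
    ... | z , z∈y⁺ , inj₂ x∧y∨z =
      ∈⁺⁺∧≤⇒≈ y∈x⁺⁺ (∧-codisjoint⇒≤ (∈⁺¹⇒IsComplementOf z∈y⁺) x∧y∨z)

theorem2p7 : ∀ {c ℓ} (L : ComplementedModularLattice c ℓ) →
    (ConditionI L → ConditionII L) × (ConditionII L → ConditionI L)
theorem2p7 L = ComplementedModular.i⇒ii L , ComplementedModular.ii⇒i L
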